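{- Fix an integer $\ell\geq4$. Let $G$ be a graph and let $C$ be a shortest long even hole in $G$. Let $x,y$ be non-adjacent $C$-major vertices, and suppose all neighbours of $x$ in $V(C)$ are contained in a $y$-gap $P$. Then there is an $xy$-gap of length at most $\lceil \ell/2\rceil-3$ contained in $P$.
   Context: A hole is an induced cycle of length at least four; long means length at least $\ell$; a shortest long even hole is an even long hole of minimum length in $G$. A vertex $v\notin V(C)$ is $C$-major if no subpath of $C$ of length three contains all its neighbours in $V(C)$. For a $C$-major vertex $y$, a $y$-gap is a subpath $P$ of $C$ of length at least two whose two ends are neighbours of $y$ and none of whose interior vertices is adjacent to $y$. For non-adjacent $C$-major vertices $x,y$, an $xy$-gap is a path $P$ of $C$ such that $V(P)$ is the set of interior vertices of some $xy$-path. -}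

module Defs where

open import Level using (0ℓ)
open import Data.Nat using (ℕ; zero; suc; _+_; _≤_; _<_; s≤s; z≤n; ⌈_/2⌉; NonZero; >-nonZero)
open import Data.Nat.DivMod using (_mod_)
open import Data.Nat.Divisibility using (_∣_)
open import Data.Nat.Properties using (≤-trans)
open import Data.Fin using (Fin; toℕ; fromℕ)
open import Data.Product using (Σ; Σ-syntax; ∃; _×_)
open import Data.Sum using (_⊎_)
open import Data.Empty using (⊥)
open import Relation.Nullary using (¬_; Dec)
open import Relation.Binary.PropositionalEquality using (_≡_; _≢_)
open import Function.Bundles using (_⇔_)
open import Function.Definitions using (Injective)

record Graph (n : ℕ) : Set₁ where
  field
    _~_    : Fin n → Fin n → Set
    ~-sym  : ∀ {u v} → u ~ v → v ~ u
    ~-irr  : ∀ {u} → ¬ (u ~ u)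
    ~-dec  : ∀ u v → Dec (u ~ v)
open Graph public

module _ {n : ℕ} (G : Graph n) where
  private
    _~G_ = _~_ G

  record Hole : Set where
    field
      len     : ℕ
      len≥4   : 4 ≤ len
      cyc     : Fin len → Fin n
      cyc-inj : Injective _≡_ _≡_ cyc
    idx : ℕ → Fin len
    idx t = _mod_ t len {{>-nonZero (≤-trans (s≤s z≤n) len≥4)}}
    at : ℕ → Fin n
    at t = cyc (idx t)
    field
      induced : ∀ i j → (cyc i ~G cyc j) ⇔
                        (idx (suc (toℕ i)) ≡ j ⊎ idx (suc (toℕ j)) ≡ i)
  open Hole public

  LongEvenHole : ℕ → Hole → Set
  LongEvenHole ℓ C = ℓ ≤ len C × 2 ∣ len C

  ShortestLongEvenHole : ℕ → Hole → Set
  ShortestLongEvenHole ℓ C =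
    LongEvenHole ℓ C × (∀ (D : Hole) → LongEvenHole ℓ D → len C ≤ len D)

  record IPath : Set where
    field
      plen    : ℕ
      pv      : Fin (suc plen) → Fin n
      pv-inj  : Injective _≡_ _≡_ pv
      induced : ∀ a b → (pv a ~G pv b) ⇔
                        (toℕ b ≡ suc (toℕ a) ⊎ toℕ a ≡ suc (toℕ b))
    first : Fin n
    first = pv Fin.zero
    last : Fin n
    last = pv (fromℕ plen)
    Interior : Fin n → Set
    Interior v = Σ[ a ∈ Fin (suc plen) ] (0 < toℕ a × toℕ a < plen × pv a ≡ v)
  open IPath public

  module _ (C : Hole) where
    record SubPath : Set where
      field
        start : ℕ
        slen  : ℕ
        slen<len : slen < len C
      sfirst : Fin n
      sfirst = at C start
      slast : Fin n
      slast = at C (start + slen)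
      InSub : Fin n → Set
      InSub v = Σ[ t ∈ ℕ ] (t ≤ slen × at C (start + t) ≡ v)
    open SubPath public

    Major : Fin n → Set
    Major v = (∀ i → cyc C i ≢ v)
            × ¬ (Σ[ Q ∈ SubPath ] (slen Q ≡ 3 × (∀ i → v ~G cyc C i → InSub Q (cyc C i))))

    Gap : Fin n → SubPath → Set
    Gap y P = 2 ≤ slen P × y ~G sfirst P × y ~G slast P
            × (∀ t → 0 < t → t < slen P → ¬ (y ~G at C (start P + t)))

    XYPath : Fin n → Fin n → IPath → Set
    XYPath x y R = first R ≡ x × last R ≡ y

    XYGap : Fin n → Fin n → SubPath → Set
    XYGap x y Q = Σ[ R ∈ IPath ] (XYPath x y R × (∀ v → Interior R v ⇔ InSub Q v))

module Submission where

-- Write p₀ … pₛ for the y-gap P and let pₐ and p_b, b = a + m, be the first and last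
-- neighbours of x on P; then m ≥ 4 because x is major, and s + 3 ≤ |C| because y is.
-- The subpaths p₀ … pₐ and p_b … pₛ are xy-gaps, of lengths a and d = s − b. If both
-- are longer than ⌈ℓ/2⌉ − 3, then the hole y p₀ … pₐ x p_b … pₛ y has length a + d + 4 ≥ ℓ,
-- and so have the holes y p₀ … pₛ y, of length s + 2, and x p_b … pₐ x running round the
-- rest of C, of length |C| − m + 2. All three are shorter than C, and their lengths satisfy
-- (s + 2) + (|C| − m + 2) = |C| + (a + d + 4) with |C| even, so one of them is a long even
-- hole shorter than C.

open import Defs
open import Data.Nat
  using (ℕ; zero; suc; _+_; _*_; _∸_; _≤_; _<_; _≤?_; _≤ᵇ_; z≤n; s≤s; NonZero; >-nonZero; _%_; _/_; ⌈_/2⌉; ⌊_/2⌋)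
open import Data.Nat.Properties
open import Data.Nat.DivMod
  using (_mod_; m%n<n; m<n⇒m%n≡m; n%n≡0; %-distribˡ-+; m%n%n≡m%n; [m+n]%n≡m%n; [m+kn]%n≡m%n; m≡m%n+[m/n]*n; m%n≤n)
open import Data.Nat.Divisibility using (_∣_; divides; >⇒∤; ∣m+n∣m⇒∣n; ∣m∣n⇒∣m+n; ∣-refl)
open import Data.Fin using (Fin; toℕ; fromℕ<)
open import Data.Fin.Properties using (toℕ-injective; toℕ<n; toℕ-fromℕ<; toℕ-fromℕ)
open import Data.Bool using (if_then_else_; true; false; T)
open import Data.Unit using (tt)
open import Data.Product using (Σ-syntax; ∃-syntax; _×_; _,_; proj₁; proj₂)
open import Data.Sum using (_⊎_; inj₁; inj₂)
import Data.Sum as Sum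
open import Function using (_∘_; const; id; flip)
open import Function.Bundles using (_⇔_; mk⇔; Equivalence)
import Function.Properties.Equivalence as Eq
open import Relation.Nullary using (¬_; yes; no; contradiction)
open import Relation.Unary using (Decidable)
open import Data.Empty using (⊥-elim)
open import Relation.Binary.PropositionalEquality
open import Data.Nat.Tactic.RingSolver using (solve-∀)
open import Algebra.Properties.CommutativeSemigroup +-commutativeSemigroup
  using (x∙yz≈y∙xz; xy∙z≈xz∙y; x∙yz≈xz∙y)

m+n≡o+p⇒n≡p : ∀ {m n o p} → m + n ≡ o + p → m ≤ o → n ≤ p → n ≡ p
m+n≡o+p⇒n≡p {m} {n} {o} {p} eq m≤o n≤p =
  ≤-antisym n≤p (+-cancelˡ-≤ o p n (≤-trans (≤-reflexive (sym eq)) (+-monoˡ-≤ n m≤o)))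

m∸o≡1+m∸n⇒n≡1+o : ∀ {m n o} → n ≤ m → o ≤ m → m ∸ o ≡ suc (m ∸ n) → n ≡ suc o
m∸o≡1+m∸n⇒n≡1+o {m} {n} {o} n≤m o≤m eq = +-cancelʳ-≡ (m ∸ n) n (suc o) (begin
  n + (m ∸ n)      ≡⟨ m+[n∸m]≡n n≤m ⟩
  m                ≡⟨ m+[n∸m]≡n o≤m ⟨
  o + (m ∸ o)      ≡⟨ cong (o +_) eq ⟩
  o + suc (m ∸ n)  ≡⟨ +-suc o (m ∸ n) ⟩
  suc o + (m ∸ n)  ∎)
  where open ≡-Reasoning

module _ (k : ℕ) .{{_ : NonZero k}} where

  [m+n%k]%k≡[m+n]%k : ∀ m n → (m + n % k) % k ≡ (m + n) % k
  [m+n%k]%k≡[m+n]%k m n = begin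
    (m + n % k) % k          ≡⟨ %-distribˡ-+ m (n % k) k ⟩
    (m % k + n % k % k) % k  ≡⟨ cong (λ z → (m % k + z) % k) (m%n%n≡m%n n k) ⟩
    (m % k + n % k) % k      ≡⟨ %-distribˡ-+ m n k ⟨
    (m + n) % k              ∎
    where open ≡-Reasoning

  m+[k∸m%k]≡[1+m/k]*k : ∀ m → m + (k ∸ m % k) ≡ suc (m / k) * k
  m+[k∸m%k]≡[1+m/k]*k m = begin
    m + (k ∸ m % k)                    ≡⟨ cong (_+ (k ∸ m % k)) (m≡m%n+[m/n]*n m k) ⟩
    m % k + m / k * k + (k ∸ m % k)    ≡⟨ xy∙z≈xz∙y (m % k) (m / k * k) (k ∸ m % k) ⟩
    m % k + (k ∸ m % k) + m / k * k    ≡⟨ cong (_+ m / k * k) (m+[n∸m]≡n (m%n≤n m k)) ⟩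
    k + m / k * k                      ∎
    where open ≡-Reasoning

  %-≡⇒∣∸ : ∀ {m o} → m % k ≡ o % k → k ∣ o ∸ m
  %-≡⇒∣∸ {m} {o} eq = divides (o / k ∸ m / k) (begin
    o ∸ m                                  ≡⟨ cong₂ _∸_ (m≡m%n+[m/n]*n o k) (m≡m%n+[m/n]*n m k) ⟩
    (o % k + o / k * k) ∸ (m % k + m / k * k) ≡⟨ cong (λ r → (o % k + o / k * k) ∸ (r + m / k * k)) eq ⟩
    (o % k + o / k * k) ∸ (o % k + m / k * k) ≡⟨ [m+n]∸[m+o]≡n∸o (o % k) _ _ ⟩
    o / k * k ∸ m / k * k                  ≡⟨ *-distribʳ-∸ k (o / k) (m / k) ⟨
    (o / k ∸ m / k) * k                    ∎)
    where open ≡-Reasoning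

  ∣∧<⇒≡0 : ∀ {d} → k ∣ d → d < k → d ≡ 0
  ∣∧<⇒≡0 {zero}  _   _   = refl
  ∣∧<⇒≡0 {suc d} k∣d d<k = contradiction k∣d (>⇒∤ d<k)

  %-≡⇒≡-ordered : ∀ {m o} → m ≤ o → o < m + k → m % k ≡ o % k → m ≡ o
  %-≡⇒≡-ordered {m} m≤o o<m+k eq with m≤n⇒∃[o]m+o≡n m≤o
  ... | d , refl = sym (trans (cong (m +_) d≡0) (+-identityʳ m))
    where
      d≡0 : d ≡ 0
      d≡0 = ∣∧<⇒≡0 (subst (k ∣_) (m+n∸m≡n m d) (%-≡⇒∣∸ eq)) (+-cancelˡ-< m d k o<m+k)

  %-≡⇒≡ : ∀ {m o} → m < o + k → o < m + k → m % k ≡ o % k → m ≡ o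
  %-≡⇒≡ {m} {o} m<o+k o<m+k eq with ≤-total m o
  ... | inj₁ m≤o = %-≡⇒≡-ordered m≤o o<m+k eq
  ... | inj₂ o≤m = sym (%-≡⇒≡-ordered o≤m m<o+k (sym eq))

  %-≡⇒≡∨≡+ : ∀ {m o} → m ≤ o → o ≤ m + k → m % k ≡ o % k → o ≡ m ⊎ o ≡ m + k
  %-≡⇒≡∨≡+ m≤o o≤m+k eq with m≤n⇒m<n∨m≡n o≤m+k
  ... | inj₁ o<m+k = inj₁ (sym (%-≡⇒≡-ordered m≤o o<m+k eq))
  ... | inj₂ o≡m+k = inj₂ o≡m+k

  %-window-cover : ∀ m t → ∃[ j ] (j < k × (m + j) % k ≡ t % k)
  %-window-cover m t = (t + (k ∸ m % k)) % k , m%n<n _ k , (begin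
    (m + (t + (k ∸ m % k)) % k) % k  ≡⟨ [m+n%k]%k≡[m+n]%k m _ ⟩
    (m + (t + (k ∸ m % k))) % k      ≡⟨ cong (_% k) (x∙yz≈y∙xz m t _) ⟩
    (t + (m + (k ∸ m % k))) % k      ≡⟨ cong (λ z → (t + z) % k) (m+[k∸m%k]≡[1+m/k]*k m) ⟩
    (t + suc (m / k) * k) % k        ≡⟨ [m+kn]%n≡m%n t (suc (m / k)) k ⟩
    t % k                            ∎)
    where open ≡-Reasoning

2∣n⊎2∣1+n : ∀ n → 2 ∣ n ⊎ 2 ∣ suc n
2∣n⊎2∣1+n zero    = inj₁ (divides 0 refl)
2∣n⊎2∣1+n (suc n) = Sum.swap (Sum.map₁ (∣m∣n⇒∣m+n ∣-refl) (2∣n⊎2∣1+n n))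

2∤n⇒2∣1+n : ∀ {n} → ¬ 2 ∣ n → 2 ∣ suc n
2∤n⇒2∣1+n {n} 2∤n = Sum.[ flip contradiction 2∤n , id ]′ (2∣n⊎2∣1+n n)

odd+h≡even+odd⇒2∣h : ∀ {h₁ h₂ e h₃} → h₁ + h₂ ≡ e + h₃ → 2 ∣ e → ¬ 2 ∣ h₁ → ¬ 2 ∣ h₃ → 2 ∣ h₂
odd+h≡even+odd⇒2∣h {h₁} {h₂} {e} {h₃} eq 2∣e 2∤h₁ 2∤h₃ = ∣m+n∣m⇒∣n 2∣1+h₁+h₂ (2∤n⇒2∣1+n 2∤h₁)
  where
    2∣1+h₁+h₂ : 2 ∣ suc h₁ + h₂
    2∣1+h₁+h₂ = subst (2 ∣_) (trans (+-suc e h₃) (cong suc (sym eq)))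
                      (∣m∣n⇒∣m+n 2∣e (2∤n⇒2∣1+n 2∤h₃))

⌈/2⌉-split : ∀ ℓ a d → a + 3 ≤ ⌈ ℓ /2⌉ ⊎ d + 3 ≤ ⌈ ℓ /2⌉ ⊎ ℓ ≤ a + d + 4
⌈/2⌉-split ℓ a d with a + 3 ≤? ⌈ ℓ /2⌉ | d + 3 ≤? ⌈ ℓ /2⌉
... | yes a+3≤ | _        = inj₁ a+3≤
... | no _     | yes d+3≤ = inj₂ (inj₁ d+3≤)
... | no a+3≰  | no d+3≰  = inj₂ (inj₂ (begin
  ℓ                      ≡⟨ ⌊n/2⌋+⌈n/2⌉≡n ℓ ⟨
  ⌊ ℓ /2⌋ + ⌈ ℓ /2⌉      ≤⟨ +-mono-≤ (≤-trans (⌊n/2⌋≤⌈n/2⌉ ℓ) (below a a+3≰)) (below d d+3≰) ⟩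
  (a + 2) + (d + 2)      ≡⟨ rearrange a d ⟩
  a + d + 4              ∎))
  where
    open ≤-Reasoning
    below : ∀ t → ¬ t + 3 ≤ ⌈ ℓ /2⌉ → ⌈ ℓ /2⌉ ≤ t + 2
    below t t+3≰ = ≤-pred (subst (⌈ ℓ /2⌉ <_) (+-suc t 2) (≰⇒> t+3≰))
    rearrange : ∀ a d → (a + 2) + (d + 2) ≡ a + d + 4
    rearrange = solve-∀

module _ {P : ℕ → Set} where

  private
    ¬P-≤-suc : ∀ {k t} → t ≤ suc k → (t ≤ k → ¬ P t) → ¬ P (suc k) → ¬ P t
    ¬P-≤-suc t≤1+k ¬P-≤k ¬P[1+k] =
      Sum.[ ¬P-≤k ∘ m<1+n⇒m≤n , (λ { refl → ¬P[1+k] }) ]′ (m≤n⇒m<n∨m≡n t≤1+k)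

  module _ (P? : Decidable P) where

    least-≤ : ∀ k → (∃[ a ] (a ≤ k × P a × (∀ {t} → t < a → ¬ P t))) ⊎ (∀ {t} → t ≤ k → ¬ P t)
    least-≤ zero with P? 0
    ... | yes P0 = inj₁ (0 , z≤n , P0 , λ ())
    ... | no ¬P0 = inj₂ λ { z≤n → ¬P0 }
    least-≤ (suc k) with least-≤ k
    ... | inj₁ (a , a≤k , Pa , before) = inj₁ (a , m≤n⇒m≤1+n a≤k , Pa , before)
    ... | inj₂ none with P? (suc k)
    ...   | yes P[1+k] = inj₁ (suc k , ≤-refl , P[1+k] , none ∘ m<1+n⇒m≤n)
    ...   | no ¬P[1+k] = inj₂ (λ t≤1+k → ¬P-≤-suc t≤1+k none ¬P[1+k])

    greatest-≤ : ∀ k →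
      (∃[ b ] (b ≤ k × P b × (∀ {t} → b < t → t ≤ k → ¬ P t))) ⊎ (∀ {t} → t ≤ k → ¬ P t)
    greatest-≤ zero with P? 0
    ... | yes P0 = inj₁ (0 , z≤n , P0 , λ 0<t t≤0 → contradiction (<-≤-trans 0<t t≤0) (n≮n 0))
    ... | no ¬P0 = inj₂ λ { z≤n → ¬P0 }
    greatest-≤ (suc k) with P? (suc k)
    ... | yes P[1+k] = inj₁ (suc k , ≤-refl , P[1+k] , λ k<t t≤k → contradiction (<-≤-trans k<t t≤k) (n≮n _))
    ... | no ¬P[1+k] with greatest-≤ k
    ...   | inj₁ (b , b≤k , Pb , after) = inj₁ (b , m≤n⇒m≤1+n b≤k , Pb ,
                                            λ b<t t≤1+k → ¬P-≤-suc t≤1+k (after b<t) ¬P[1+k])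
    ...   | inj₂ none = inj₂ (λ t≤1+k → ¬P-≤-suc t≤1+k none ¬P[1+k])

CyclicSuccessor : ℕ → ℕ → ℕ → Set
CyclicSuccessor k i j = j ≡ suc i ⊎ (suc i ≡ k × j ≡ 0)

suc-mod≡⇔CyclicSuccessor : ∀ k .{{_ : NonZero k}} (a b : Fin k) →
  (suc (toℕ a) mod k ≡ b) ⇔ CyclicSuccessor k (toℕ a) (toℕ b)
suc-mod≡⇔CyclicSuccessor k a b = mk⇔ to from
  where
    to : suc (toℕ a) mod k ≡ b → CyclicSuccessor k (toℕ a) (toℕ b)
    to refl with m≤n⇒m<n∨m≡n (toℕ<n a)
    ... | inj₁ a+1<k = inj₁ (trans (toℕ-fromℕ< _) (m<n⇒m%n≡m a+1<k))
    ... | inj₂ a+1≡k = inj₂ (a+1≡k , trans (toℕ-fromℕ< _) (trans (cong (_% k) a+1≡k) (n%n≡0 k)))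
    from : CyclicSuccessor k (toℕ a) (toℕ b) → suc (toℕ a) mod k ≡ b
    from (inj₁ b≡a+1) = toℕ-injective (trans (toℕ-fromℕ< _)
      (trans (m<n⇒m%n≡m (subst (_< k) b≡a+1 (toℕ<n b))) (sym b≡a+1)))
    from (inj₂ (a+1≡k , b≡0)) = toℕ-injective (trans (toℕ-fromℕ< _)
      (trans (cong (_% k) a+1≡k) (trans (n%n≡0 k) (sym b≡0))))

module InducedPaths {n : ℕ} (G : Graph n) where

  open Graph G using () renaming (~-sym to ∼-sym; ~-irr to ∼-irrefl)

  infix 4 _∼_
  _∼_ : Fin n → Fin n → Set
  _∼_ = _~_ G

  Walk : Set
  Walk = ℕ → Fin n

  record IsInducedPath (r : ℕ) (w : Walk) : Set where
    field
      injective            : ∀ {i j} → i ≤ r → j ≤ r → w i ≡ w j → i ≡ j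
      adjacent⇒consecutive : ∀ {i j} → i ≤ r → j ≤ r → w i ∼ w j → j ≡ suc i ⊎ i ≡ suc j
      consecutive⇒adjacent : ∀ {i} → suc i ≤ r → w i ∼ w (suc i)

  toIPath : ∀ {r w} → IsInducedPath r w → IPath G
  toIPath {r} {w} p = record
    { plen    = r
    ; pv      = w ∘ toℕ
    ; pv-inj  = λ {a} {b} → toℕ-injective ∘ injective (bound a) (bound b)
    ; induced = λ a b → mk⇔ (adjacent⇒consecutive (bound a) (bound b)) (edge a b)
    }
    where
      open IsInducedPath p
      bound : (a : Fin (suc r)) → toℕ a ≤ r
      bound a = m<1+n⇒m≤n (toℕ<n a)
      forward : ∀ a b → toℕ b ≡ suc (toℕ a) → w (toℕ a) ∼ w (toℕ b)
      forward a b b≡a+1 rewrite b≡a+1 = consecutive⇒adjacent (subst (_≤ r) b≡a+1 (bound b))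
      edge : ∀ a b → toℕ b ≡ suc (toℕ a) ⊎ toℕ a ≡ suc (toℕ b) → w (toℕ a) ∼ w (toℕ b)
      edge a b (inj₁ b≡a+1) = forward a b b≡a+1
      edge a b (inj₂ a≡b+1) = ∼-sym (forward b a a≡b+1)

  record IsInducedCycle (k : ℕ) (w : Walk) : Set where
    field
      injective             : ∀ {i j} → i < k → j < k → w i ≡ w j → i ≡ j
      adjacent⇒successive   : ∀ {i j} → i < k → j < k → w i ∼ w j →
                              CyclicSuccessor k i j ⊎ CyclicSuccessor k j i
      successive⇒adjacent   : ∀ {i j} → i < k → j < k → CyclicSuccessor k i j → w i ∼ w j

  toHole : ∀ {k w} → 4 ≤ k → IsInducedCycle k w → Hole G
  toHole {k} {w} 4≤k c = record
    { len     = k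
    ; len≥4   = 4≤k
    ; cyc     = w ∘ toℕ
    ; cyc-inj = λ {a} {b} → toℕ-injective ∘ injective (toℕ<n a) (toℕ<n b)
    ; induced = λ a b → mk⇔ (to a b) (from a b)
    }
    where
      open IsInducedCycle c
      instance
        k-nonZero : NonZero k
        k-nonZero = >-nonZero (≤-trans (s≤s z≤n) 4≤k)
      to : ∀ a b → w (toℕ a) ∼ w (toℕ b) → suc (toℕ a) mod k ≡ b ⊎ suc (toℕ b) mod k ≡ a
      to a b wa∼wb with adjacent⇒successive (toℕ<n a) (toℕ<n b) wa∼wb
      ... | inj₁ a↦b = inj₁ (Equivalence.from (suc-mod≡⇔CyclicSuccessor k a b) a↦b)
      ... | inj₂ b↦a = inj₂ (Equivalence.from (suc-mod≡⇔CyclicSuccessor k b a) b↦a)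
      from : ∀ a b → suc (toℕ a) mod k ≡ b ⊎ suc (toℕ b) mod k ≡ a → w (toℕ a) ∼ w (toℕ b)
      from a b (inj₁ a↦b) =
        successive⇒adjacent (toℕ<n a) (toℕ<n b) (Equivalence.to (suc-mod≡⇔CyclicSuccessor k a b) a↦b)
      from a b (inj₂ b↦a) =
        ∼-sym (successive⇒adjacent (toℕ<n b) (toℕ<n a) (Equivalence.to (suc-mod≡⇔CyclicSuccessor k b a) b↦a))

  isInducedPath-singleton : ∀ v → IsInducedPath 0 (const v)
  isInducedPath-singleton v = record
    { injective            = λ { z≤n z≤n _ → refl }
    ; adjacent⇒consecutive = λ _ _ v∼v → contradiction v∼v ∼-irrefl
    ; consecutive⇒adjacent = λ ()
    }

  append : ℕ → Walk → Walk → Walk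
  append r₁ w₁ w₂ i = if i ≤ᵇ r₁ then w₁ i else w₂ (i ∸ suc r₁)

  infixr 5 _◃_
  _◃_ : Fin n → Walk → Walk
  v ◃ w = append 0 (const v) w

  module _ {r₁ : ℕ} {w₁ w₂ : Walk} where

    append-left : ∀ {i} → i ≤ r₁ → append r₁ w₁ w₂ i ≡ w₁ i
    append-left {i} i≤r₁ with i ≤ᵇ r₁ | ≤⇒≤ᵇ i≤r₁
    ... | true | _ = refl

    append-right : ∀ {i} → r₁ < i → append r₁ w₁ w₂ i ≡ w₂ (i ∸ suc r₁)
    append-right {i} r₁<i with i ≤ᵇ r₁ in i≤ᵇr₁
    ... | true  = contradiction (≤ᵇ⇒≤ i r₁ (subst T (sym i≤ᵇr₁) tt)) (<⇒≱ r₁<i)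
    ... | false = refl

    append-right⁺ : ∀ j → append r₁ w₁ w₂ (suc r₁ + j) ≡ w₂ j
    append-right⁺ j = trans (append-right (m≤m+n (suc r₁) j)) (cong w₂ (m+n∸m≡n (suc r₁) j))

  data Split (r₁ r₂ : ℕ) : ℕ → Set where
    left  : ∀ {i} → i ≤ r₁ → Split r₁ r₂ i
    right : ∀ {j} → j ≤ r₂ → Split r₁ r₂ (suc r₁ + j)

  split : ∀ r₁ r₂ {i} → i ≤ r₁ + suc r₂ → Split r₁ r₂ i
  split r₁ r₂ {i} i≤r with i ≤? r₁
  ... | yes i≤r₁ = left i≤r₁
  ... | no  i≰r₁ = subst (Split r₁ r₂) (m+[n∸m]≡n (≰⇒> i≰r₁))
                     (right (m≤n+o⇒m∸n≤o i (suc r₁) (subst (i ≤_) (+-suc r₁ r₂) i≤r)))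

  isInducedPath-++ : ∀ {r₁ r₂ w₁ w₂} → IsInducedPath r₁ w₁ → IsInducedPath r₂ w₂ →
    (∀ {i j} → i ≤ r₁ → j ≤ r₂ → w₁ i ≢ w₂ j) →
    (∀ {i j} → i ≤ r₁ → j ≤ r₂ → w₁ i ∼ w₂ j → i ≡ r₁ × j ≡ 0) →
    w₁ r₁ ∼ w₂ 0 →
    IsInducedPath (r₁ + suc r₂) (append r₁ w₁ w₂)
  isInducedPath-++ {r₁} {r₂} {w₁} {w₂} p₁ p₂ disjoint only-link link = record
    { injective            = injective
    ; adjacent⇒consecutive = adjacent⇒consecutive
    ; consecutive⇒adjacent = consecutive⇒adjacent
    }
    where
      module P₁ = IsInducedPath p₁
      module P₂ = IsInducedPath p₂
      w = append r₁ w₁ w₂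
      onˡ : ∀ {i} → i ≤ r₁ → w i ≡ w₁ i
      onˡ = append-left {r₁} {w₁} {w₂}
      onʳ : ∀ j → w (suc r₁ + j) ≡ w₂ j
      onʳ = append-right⁺ {r₁} {w₁} {w₂}

      injective : ∀ {i j} → i ≤ r₁ + suc r₂ → j ≤ r₁ + suc r₂ → w i ≡ w j → i ≡ j
      injective hi hj wi≡wj with split r₁ r₂ hi | split r₁ r₂ hj
      ... | left a  | left b  = P₁.injective a b (trans (sym (onˡ a)) (trans wi≡wj (onˡ b)))
      ... | left a  | right {j} b = contradiction (trans (sym (onˡ a)) (trans wi≡wj (onʳ j))) (disjoint a b)
      ... | right {i} a | left b = contradiction (trans (sym (onˡ b)) (trans (sym wi≡wj) (onʳ i))) (disjoint b a)
      ... | right {i} a | right {j} b = cong (suc r₁ +_) (P₂.injective a b (trans (sym (onʳ i)) (trans wi≡wj (onʳ j))))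

      adjacent⇒consecutive : ∀ {i j} → i ≤ r₁ + suc r₂ → j ≤ r₁ + suc r₂ → w i ∼ w j →
                             j ≡ suc i ⊎ i ≡ suc j
      adjacent⇒consecutive hi hj wi∼wj with split r₁ r₂ hi | split r₁ r₂ hj
      ... | left a | left b = P₁.adjacent⇒consecutive a b (subst₂ _∼_ (onˡ a) (onˡ b) wi∼wj)
      ... | left a | right {j} b with only-link a b (subst₂ _∼_ (onˡ a) (onʳ j) wi∼wj)
      ...   | refl , refl = inj₁ (cong suc (+-identityʳ r₁))
      adjacent⇒consecutive hi hj wi∼wj | right {i} a | left b
        with only-link b a (subst₂ _∼_ (onˡ b) (onʳ i) (∼-sym wi∼wj))
      ...   | refl , refl = inj₂ (cong suc (+-identityʳ r₁))
      adjacent⇒consecutive hi hj wi∼wj | right {i} a | right {j} b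
        with P₂.adjacent⇒consecutive a b (subst₂ _∼_ (onʳ i) (onʳ j) wi∼wj)
      ... | inj₁ refl = inj₁ (cong suc (+-suc r₁ i))
      ... | inj₂ refl = inj₂ (cong suc (+-suc r₁ j))

      consecutive⇒adjacent : ∀ {i} → suc i ≤ r₁ + suc r₂ → w i ∼ w (suc i)
      consecutive⇒adjacent {i} hi with split r₁ r₂ (≤-trans (n≤1+n i) hi)
      ... | right {j} b = subst₂ _∼_ (sym (onʳ j)) (sym (trans (cong w (sym (+-suc (suc r₁) j))) (onʳ (suc j))))
                            (P₂.consecutive⇒adjacent (+-cancelˡ-≤ r₁ (suc j) r₂
                              (≤-pred (subst₂ _≤_ (cong suc (sym (+-suc r₁ j))) (+-suc r₁ r₂) hi))))
      ... | left b with m≤n⇒m<n∨m≡n b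
      ...   | inj₁ i<r₁ = subst₂ _∼_ (sym (onˡ b)) (sym (onˡ i<r₁)) (P₁.consecutive⇒adjacent i<r₁)
      ...   | inj₂ refl = subst₂ _∼_ (sym (onˡ b)) (sym (trans (cong w (sym (+-identityʳ (suc r₁)))) (onʳ 0))) link

  isInducedPath-reverse : ∀ {r w} → IsInducedPath r w → IsInducedPath r (λ i → w (r ∸ i))
  isInducedPath-reverse {r} {w} p = record
    { injective            = λ {i} {j} hi hj → ∸-cancelˡ-≡ hi hj ∘ P.injective (m∸n≤m r i) (m∸n≤m r j)
    ; adjacent⇒consecutive = adjacent⇒consecutive
    ; consecutive⇒adjacent = consecutive⇒adjacent
    }
    where
      module P = IsInducedPath p
      adjacent⇒consecutive : ∀ {i j} → i ≤ r → j ≤ r → w (r ∸ i) ∼ w (r ∸ j) → j ≡ suc i ⊎ i ≡ suc j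
      adjacent⇒consecutive {i} {j} hi hj wi∼wj with P.adjacent⇒consecutive (m∸n≤m r i) (m∸n≤m r j) wi∼wj
      ... | inj₁ eq = inj₂ (m∸o≡1+m∸n⇒n≡1+o hi hj eq)
      ... | inj₂ eq = inj₁ (m∸o≡1+m∸n⇒n≡1+o hj hi eq)
      consecutive⇒adjacent : ∀ {i} → suc i ≤ r → w (r ∸ i) ∼ w (r ∸ suc i)
      consecutive⇒adjacent {i} hi = ∼-sym (subst (λ t → w (r ∸ suc i) ∼ w t) (sym r∸i≡1+r∸[1+i])
        (P.consecutive⇒adjacent (subst (_≤ r) r∸i≡1+r∸[1+i] (m∸n≤m r i))))
        where
          r∸i≡1+r∸[1+i] : r ∸ i ≡ suc (r ∸ suc i)
          r∸i≡1+r∸[1+i] = +-∸-assoc 1 hi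

  isInducedPath-shift : ∀ {s w} c r → c + r ≤ s → IsInducedPath s w → IsInducedPath r (λ j → w (c + j))
  isInducedPath-shift {s} {w} c r c+r≤s p = record
    { injective            = λ hi hj → +-cancelˡ-≡ c _ _ ∘ P.injective (bound hi) (bound hj)
    ; adjacent⇒consecutive = adjacent⇒consecutive
    ; consecutive⇒adjacent = λ {i} hi →
        subst (λ t → w (c + i) ∼ w t) (sym (+-suc c i)) (P.consecutive⇒adjacent (subst (_≤ s) (+-suc c i) (bound hi)))
    }
    where
      module P = IsInducedPath p
      bound : ∀ {j} → j ≤ r → c + j ≤ s
      bound j≤r = ≤-trans (+-monoʳ-≤ c j≤r) c+r≤s
      adjacent⇒consecutive : ∀ {i j} → i ≤ r → j ≤ r → w (c + i) ∼ w (c + j) → j ≡ suc i ⊎ i ≡ suc j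
      adjacent⇒consecutive hi hj wi∼wj with P.adjacent⇒consecutive (bound hi) (bound hj) wi∼wj
      ... | inj₁ eq = inj₁ (+-cancelˡ-≡ c _ _ (trans eq (sym (+-suc c _))))
      ... | inj₂ eq = inj₂ (+-cancelˡ-≡ c _ _ (trans eq (sym (+-suc c _))))

  data ApexSplit (r : ℕ) : ℕ → Set where
    onPath : ∀ {i} → i ≤ r → ApexSplit r i
    atApex : ApexSplit r (suc r)

  apexSplit : ∀ {r i} → i < suc (suc r) → ApexSplit r i
  apexSplit i<r+2 with m<1+n⇒m<n∨m≡n i<r+2
  ... | inj₁ i<r+1 = onPath (m<1+n⇒m≤n i<r+1)
  ... | inj₂ refl  = atApex

  isInducedCycle-apex : ∀ {r w z} → IsInducedPath r w →
    (∀ {i} → i ≤ r → w i ≢ z) → (∀ {i} → i ≤ r → z ∼ w i → i ≡ 0 ⊎ i ≡ r) →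
    z ∼ w 0 → z ∼ w r →
    IsInducedCycle (suc (suc r)) (append r w (const z))
  isInducedCycle-apex {r} {w} {z} p z∉w z∼ends z∼first z∼last = record
    { injective           = injective
    ; adjacent⇒successive = adjacent⇒successive
    ; successive⇒adjacent = successive⇒adjacent
    }
    where
      module P = IsInducedPath p
      k = suc (suc r)
      c = append r w (const z)
      onPath≡ : ∀ {i} → i ≤ r → c i ≡ w i
      onPath≡ = append-left {r} {w} {const z}
      atApex≡ : c (suc r) ≡ z
      atApex≡ = append-right {r} {w} {const z} ≤-refl

      injective : ∀ {i j} → i < k → j < k → c i ≡ c j → i ≡ j
      injective hi hj ci≡cj with apexSplit hi | apexSplit hj
      ... | onPath a | onPath b = P.injective a b (trans (sym (onPath≡ a)) (trans ci≡cj (onPath≡ b)))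
      ... | onPath a | atApex   = contradiction (trans (sym (onPath≡ a)) (trans ci≡cj atApex≡)) (z∉w a)
      ... | atApex   | onPath b = contradiction (trans (sym (onPath≡ b)) (trans (sym ci≡cj) atApex≡)) (z∉w b)
      ... | atApex   | atApex   = refl

      adjacent⇒successive : ∀ {i j} → i < k → j < k → c i ∼ c j →
                            CyclicSuccessor k i j ⊎ CyclicSuccessor k j i
      adjacent⇒successive hi hj ci∼cj with apexSplit hi | apexSplit hj
      ... | onPath a | onPath b with P.adjacent⇒consecutive a b (subst₂ _∼_ (onPath≡ a) (onPath≡ b) ci∼cj)
      ...   | inj₁ j≡i+1 = inj₁ (inj₁ j≡i+1)
      ...   | inj₂ i≡j+1 = inj₂ (inj₁ i≡j+1)
      adjacent⇒successive hi hj ci∼cj | onPath a | atApex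
        with z∼ends a (∼-sym (subst₂ _∼_ (onPath≡ a) atApex≡ ci∼cj))
      ...   | inj₁ refl = inj₂ (inj₂ (refl , refl))
      ...   | inj₂ refl = inj₁ (inj₁ refl)
      adjacent⇒successive hi hj ci∼cj | atApex | onPath b
        with z∼ends b (subst₂ _∼_ atApex≡ (onPath≡ b) ci∼cj)
      ...   | inj₁ refl = inj₁ (inj₂ (refl , refl))
      ...   | inj₂ refl = inj₂ (inj₁ refl)
      adjacent⇒successive hi hj ci∼cj | atApex | atApex = contradiction ci∼cj ∼-irrefl

      successive⇒adjacent : ∀ {i j} → i < k → j < k → CyclicSuccessor k i j → c i ∼ c j
      successive⇒adjacent {i} hi hj (inj₁ refl) with apexSplit hj
      ... | onPath b = subst₂ _∼_ (sym (onPath≡ (≤-trans (n≤1+n i) b))) (sym (onPath≡ b))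
                         (P.consecutive⇒adjacent b)
      ... | atApex   = subst₂ _∼_ (sym (onPath≡ ≤-refl)) (sym atApex≡) (∼-sym z∼last)
      successive⇒adjacent hi hj (inj₂ (refl , refl)) = subst₂ _∼_ (sym atApex≡) (sym (onPath≡ z≤n)) z∼first

  Image : ℕ → Walk → Fin n → Set
  Image r w v = ∃[ i ] (i ≤ r × w i ≡ v)

  image-reverse : ∀ {r w v} → Image r (λ i → w (r ∸ i)) v ⇔ Image r w v
  image-reverse {r} {w} = mk⇔
    (λ (i , i≤r , eq) → r ∸ i , m∸n≤m r i , eq)
    (λ (i , i≤r , eq) → r ∸ i , m∸n≤m r i , trans (cong w (m∸[m∸n]≡n i≤r)) eq)

  image-cong : ∀ {r w w' v} → (∀ i → w i ≡ w' i) → Image r w v ⇔ Image r w' v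
  image-cong w≗w' = mk⇔ (λ (i , i≤r , eq) → i , i≤r , trans (sym (w≗w' i)) eq)
                        (λ (i , i≤r , eq) → i , i≤r , trans (w≗w' i) eq)

  xy-path-through : ∀ {r w x y} → IsInducedPath r w →
    (∀ {i} → i ≤ r → w i ≢ x) → (∀ {i} → i ≤ r → w i ≢ y) → x ≢ y → ¬ x ∼ y →
    (∀ {i} → i ≤ r → x ∼ w i → i ≡ 0) → (∀ {i} → i ≤ r → w i ∼ y → i ≡ r) →
    x ∼ w 0 → w r ∼ y →
    Σ[ R ∈ IPath G ] (first R ≡ x × last R ≡ y × (∀ v → Interior R v ⇔ Image r w v))
  xy-path-through {r} {w} {x} {y} p w≢x w≢y x≢y x≁y x∼only-first y∼only-last x∼first y∼last =
    toIPath path , refl , ends-at-y , λ v → mk⇔ (interior⇒image v) (image⇒interior v)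
    where
      x◃w-path : IsInducedPath (suc r) (x ◃ w)
      x◃w-path = isInducedPath-++ (isInducedPath-singleton x) p
        (λ _ hj x≡wj → w≢x hj (sym x≡wj))
        (λ { z≤n hj x∼wj → refl , x∼only-first hj x∼wj })
        x∼first
      x◃w≢y : ∀ {i j} → i ≤ suc r → j ≤ 0 → (x ◃ w) i ≢ y
      x◃w≢y {zero}  _         _ = x≢y
      x◃w≢y {suc i} (s≤s i≤r) _ = w≢y i≤r
      y∼x◃w-only-last : ∀ {i j} → i ≤ suc r → j ≤ 0 → (x ◃ w) i ∼ y → i ≡ suc r × j ≡ 0
      y∼x◃w-only-last {zero}  _         _   x∼y  = contradiction x∼y x≁y
      y∼x◃w-only-last {suc i} (s≤s i≤r) z≤n wi∼y = cong suc (y∼only-last i≤r wi∼y) , refl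
      path : IsInducedPath (suc r + suc 0) (append (suc r) (x ◃ w) (const y))
      path = isInducedPath-++ x◃w-path (isInducedPath-singleton y) x◃w≢y y∼x◃w-only-last y∼last
      len≡ : suc r + suc 0 ≡ suc (suc r)
      len≡ = +-comm (suc r) 1
      ends-at-y : last (toIPath path) ≡ y
      ends-at-y = append-right {suc r} {x ◃ w} {const y}
        (subst (suc r <_) (sym (toℕ-fromℕ (suc r + suc 0))) (≤-reflexive (sym len≡)))
      interior⇒image : ∀ v → Interior (toIPath path) v → Image r w v
      interior⇒image v (a , 0<a , a<len , eq) with toℕ a
      ... | zero  = contradiction 0<a (n≮n 0)
      ... | suc i = i , i≤r , trans (sym (append-left {suc r} {x ◃ w} {const y} (s≤s i≤r))) eq
        where
          i≤r : i ≤ r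
          i≤r = ≤-pred (≤-pred (subst (suc (suc i) ≤_) len≡ a<len))
      image⇒interior : ∀ v → Image r w v → Interior (toIPath path) v
      image⇒interior v (i , i≤r , eq) =
        a , subst (0 <_) (sym a≡1+i) (s≤s z≤n) , subst (_< suc r + suc 0) (sym a≡1+i) 1+i<len ,
        trans (cong (append (suc r) (x ◃ w) (const y)) a≡1+i)
              (trans (append-left {suc r} {x ◃ w} {const y} (s≤s i≤r)) eq)
        where
          1+i<len : suc i < suc r + suc 0
          1+i<len = subst (suc i <_) (sym len≡) (s≤s (s≤s i≤r))
          a : Fin (suc (suc r + suc 0))
          a = fromℕ< (m<n⇒m<1+n 1+i<len)
          a≡1+i : toℕ a ≡ suc i
          a≡1+i = toℕ-fromℕ< (m<n⇒m<1+n 1+i<len)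

module HolePositions {n : ℕ} {G : Graph n} (C : Hole G) where

  open InducedPaths G

  L : ℕ
  L = len C

  instance
    L-nonZero : NonZero L
    L-nonZero = >-nonZero (≤-trans (s≤s z≤n) (len≥4 C))

  idx-≡⇔ : ∀ {t t'} → idx C t ≡ idx C t' ⇔ t % L ≡ t' % L
  idx-≡⇔ {t} {t'} = mk⇔
    (λ eq → trans (sym (toℕ-fromℕ< _)) (trans (cong toℕ eq) (toℕ-fromℕ< _)))
    (λ eq → toℕ-injective (trans (toℕ-fromℕ< _) (trans eq (sym (toℕ-fromℕ< _)))))

  at-≡⇔ : ∀ {t t'} → at C t ≡ at C t' ⇔ t % L ≡ t' % L
  at-≡⇔ = mk⇔ (Equivalence.to idx-≡⇔ ∘ cyc-inj C) (cong (cyc C) ∘ Equivalence.from idx-≡⇔)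

  idx-suc-≡⇔ : ∀ {t t'} → idx C (suc (toℕ (idx C t))) ≡ idx C t' ⇔ suc t % L ≡ t' % L
  idx-suc-≡⇔ {t} {t'} = mk⇔
    (λ eq → trans (sym 1+idx-%) (Equivalence.to idx-≡⇔ eq))
    (λ eq → Equivalence.from idx-≡⇔ (trans 1+idx-% eq))
    where
      1+idx-% : suc (toℕ (idx C t)) % L ≡ suc t % L
      1+idx-% = trans (cong (λ z → suc z % L) (toℕ-fromℕ< _)) ([m+n%k]%k≡[m+n]%k L 1 t)

  at-∼⇔ : ∀ {t t'} → at C t ∼ at C t' ⇔ (suc t % L ≡ t' % L ⊎ suc t' % L ≡ t % L)
  at-∼⇔ {t} {t'} = mk⇔
    (λ t∼t' → Sum.map (Equivalence.to idx-suc-≡⇔) (Equivalence.to idx-suc-≡⇔)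
                (Equivalence.to (Hole.induced C (idx C t) (idx C t')) t∼t'))
    (λ succ → Equivalence.from (Hole.induced C (idx C t) (idx C t'))
                (Sum.map (Equivalence.from idx-suc-≡⇔) (Equivalence.from idx-suc-≡⇔) succ))

  at-+L : ∀ t → at C (t + L) ≡ at C t
  at-+L t = Equivalence.from at-≡⇔ ([m+n]%n≡m%n t L)

  cyc-in-window : ∀ u i → ∃[ k ] (k < L × at C (u + k) ≡ cyc C i)
  cyc-in-window u i with %-window-cover L u (toℕ i)
  ... | k , k<L , u+k≡i = k , k<L , trans (Equivalence.from at-≡⇔ u+k≡i) (cong (cyc C) at-toℕ)
    where
      at-toℕ : idx C (toℕ i) ≡ i
      at-toℕ = toℕ-injective (trans (toℕ-fromℕ< _) (m<n⇒m%n≡m (toℕ<n i)))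

  isInducedPath-arc : ∀ u r → r + 2 ≤ L → IsInducedPath r (λ i → at C (u + i))
  isInducedPath-arc u r r+2≤L = record
    { injective            = λ hi hj → +-cancelˡ-≡ u _ _ ∘ window (<L hi) (<L hj) ∘ Equivalence.to at-≡⇔
    ; adjacent⇒consecutive = adjacent⇒consecutive
    ; consecutive⇒adjacent = λ {i} _ → Equivalence.from at-∼⇔ (inj₁ (cong (_% L) (sym (+-suc u i))))
    }
    where
      1+<L : ∀ {i} → i ≤ r → suc i < L
      1+<L i≤r = ≤-trans (s≤s (s≤s i≤r)) (subst (_≤ L) (+-comm r 2) r+2≤L)
      <L : ∀ {i} → i ≤ r → i < L
      <L = <-trans (n<1+n _) ∘ 1+<L
      window : ∀ {i j} → i < L → j < L → (u + i) % L ≡ (u + j) % L → u + i ≡ u + j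
      window {i} {j} i<L j<L = %-≡⇒≡ L (near i<L) (near j<L)
        where
          near : ∀ {a b} → a < L → u + a < u + b + L
          near {a} {b} a<L = <-≤-trans (+-monoʳ-< u a<L) (+-monoˡ-≤ L (m≤m+n u b))
      adjacent⇒consecutive : ∀ {i j} → i ≤ r → j ≤ r → at C (u + i) ∼ at C (u + j) →
                             j ≡ suc i ⊎ i ≡ suc j
      adjacent⇒consecutive {i} {j} hi hj i∼j with Equivalence.to at-∼⇔ i∼j
      ... | inj₁ eq = inj₁ (sym (+-cancelˡ-≡ u _ _ (window (1+<L hi) (<L hj) (trans (cong (_% L) (+-suc u i)) eq))))
      ... | inj₂ eq = inj₂ (sym (+-cancelˡ-≡ u _ _ (window (1+<L hj) (<L hi) (trans (cong (_% L) (+-suc u j)) eq))))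

  record Span (v : Fin n) (s₀ a m : ℕ) : Set where
    field
      ∼left  : v ∼ at C (s₀ + a)
      ∼right : v ∼ at C (s₀ + (a + m))
      within : ∀ u → v ∼ at C u → ∃[ t ] (a ≤ t × t ≤ a + m × at C (s₀ + t) ≡ at C u)

  Major⇒¬confined : ∀ {v} → Major G C v → ∀ u k → k ≤ 3 →
    ¬ (∀ i → v ∼ cyc C i → ∃[ t ] (t ≤ k × at C (u + t) ≡ cyc C i))
  Major⇒¬confined (_ , spread) u k k≤3 confined = spread
    (record { start = u ; slen = 3 ; slen<len = len≥4 C } , refl ,
     λ i v∼i → let t , t≤k , eq = confined i v∼i in t , ≤-trans t≤k k≤3 , eq)

  gap-leaves-room : ∀ {y} {P : SubPath G C} → Major G C y → Gap G C y P → slen P + 3 ≤ L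
  gap-leaves-room {y} {P} major (_ , _ , _ , y≁inside) with slen P + 3 ≤? L
  ... | yes room = room
  ... | no ¬room = ⊥-elim (Major⇒¬confined major (s₀ + s) (L ∸ s) (≤-trans L∸s≤2 (n≤1+n 2)) confined)
    where
      s₀ = start P
      s  = slen P
      L∸s≤2 : L ∸ s ≤ 2
      L∸s≤2 = m≤n+o⇒m∸n≤o L s (≤-pred (subst (L <_) (+-suc s 2) (≰⇒> ¬room)))
      from-s : ∀ {t} → s ≤ t → at C (s₀ + s + (t ∸ s)) ≡ at C (s₀ + t)
      from-s s≤t = cong (at C) (trans (+-assoc s₀ s _) (cong (s₀ +_) (m+[n∸m]≡n s≤t)))
      confined : ∀ i → y ∼ cyc C i → ∃[ t ] (t ≤ L ∸ s × at C (s₀ + s + t) ≡ cyc C i)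
      confined i y∼i with cyc-in-window s₀ i
      ... | zero , _ , eq = L ∸ s , ≤-refl ,
            trans (from-s (<⇒≤ (slen<len P))) (trans (at-+L s₀) (trans (cong (at C) (sym (+-identityʳ s₀))) eq))
      ... | suc t , t<L , eq with suc t <? s
      ...   | yes t<s = contradiction (subst (y ∼_) (sym eq) y∼i) (y≁inside (suc t) (s≤s z≤n) t<s)
      ...   | no t≮s  = suc t ∸ s , ∸-monoˡ-≤ s (<⇒≤ t<L) , trans (from-s (≮⇒≥ t≮s)) eq

  module _ {x : Fin n} {P : SubPath G C} (major : Major G C x)
           (x-in-P : ∀ i → x ∼ cyc C i → InSub P (cyc C i)) where

    private
      x∼P? : Decidable (λ t → x ∼ at C (start P + t))
      x∼P? t = Graph.~-dec G x (at C (start P + t))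

      no-neighbour : ¬ (∀ {t} → t ≤ slen P → ¬ x ∼ at C (start P + t))
      no-neighbour none = Major⇒¬confined major (start P) 0 z≤n λ i x∼i →
        let t , t≤s , eq = x-in-P i x∼i in contradiction (subst (x ∼_) (sym eq) x∼i) (none t≤s)

      locate : ∀ {a b} → (∀ {t} → t < a → ¬ x ∼ at C (start P + t)) →
        (∀ {t} → b < t → t ≤ slen P → ¬ x ∼ at C (start P + t)) →
        ∀ i → x ∼ cyc C i → ∃[ t ] (a ≤ t × t ≤ b × at C (start P + t) ≡ cyc C i)
      locate before after i x∼i with x-in-P i x∼i
      ... | t , t≤s , eq = t , ≮⇒≥ (λ t<a → before t<a x∼t) , ≮⇒≥ (λ b<t → after b<t t≤s x∼t) , eq
        where x∼t = subst (x ∼_) (sym eq) x∼i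

    major-span : ∃[ a ] ∃[ m ] ∃[ d ] (a + m + d ≡ slen P × 4 ≤ m × Span x (start P) a m)
    major-span with least-≤ x∼P? (slen P) | greatest-≤ x∼P? (slen P)
    ... | inj₂ none | _         = ⊥-elim (no-neighbour none)
    ... | inj₁ _    | inj₂ none = ⊥-elim (no-neighbour none)
    ... | inj₁ (a , _ , x∼a , before) | inj₁ (b , b≤s , x∼b , after) with a + 4 ≤? b
    ...   | no b<a+4 = ⊥-elim (Major⇒¬confined major (start P + a) 3 ≤-refl λ i x∼i →
              let t , a≤t , t≤b , eq = locate before after i x∼i
              in t ∸ a , m≤n+o⇒m∸n≤o t a (≤-trans t≤b (≤-pred (subst (b <_) (+-suc a 3) (≰⇒> b<a+4)))) ,
                 trans (cong (at C) (trans (+-assoc (start P) a _) (cong (start P +_) (m+[n∸m]≡n a≤t)))) eq)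
    ...   | yes a+4≤b with m≤n⇒∃[o]m+o≡n (≤-trans (m≤m+n a 4) a+4≤b) | m≤n⇒∃[o]m+o≡n b≤s
    ...     | m , refl | d , a+m+d≡s = a , m , d , a+m+d≡s , +-cancelˡ-≤ a 4 m a+4≤b ,
              record { ∼left = x∼a ; ∼right = x∼b ; within = λ u → locate before after (idx C u) }

ShorterLongHole : ∀ {n} {G : Graph n} → ℕ → Hole G → Hole G → Set
ShorterLongHole ℓ C D = ℓ ≤ len D × len D < len C

module _ {n : ℕ} {G : Graph n} {ℓ : ℕ} (C : Hole G) (shortest : ShortestLongEvenHole G ℓ C) where

  shorter-long-hole-odd : ∀ D → ShorterLongHole ℓ C D → ¬ 2 ∣ len D
  shorter-long-hole-odd D (ℓ≤D , D<C) 2∣D = <⇒≱ D<C (proj₂ shortest D (ℓ≤D , 2∣D))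

  no-three-shorter-long-holes : ∀ D₁ D₂ D₃ →
    ShorterLongHole ℓ C D₁ → ShorterLongHole ℓ C D₂ → ShorterLongHole ℓ C D₃ →
    len D₁ + len D₂ ≢ len C + len D₃
  no-three-shorter-long-holes D₁ D₂ D₃ short₁ short₂ short₃ eq = shorter-long-hole-odd D₂ short₂
    (odd+h≡even+odd⇒2∣h eq (proj₂ (proj₁ shortest))
      (shorter-long-hole-odd D₁ short₁) (shorter-long-hole-odd D₃ short₃))

-- The y-gap is p₀ … p_(a+m+d) with pₜ = pos t, and x has its neighbours on C in pₐ … p_(a+m).
module Configuration {n : ℕ} {G : Graph n} (C : Hole G) {x y : Fin n}
  (x∉C : ∀ i → cyc C i ≢ x) (y∉C : ∀ i → cyc C i ≢ y) (x≢y : x ≢ y) (x≁y : ¬ _~_ G x y)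
  (s₀ a m d : ℕ) (3≤m : 3 ≤ m) (room : a + m + d + 3 ≤ len C)
  (y∼first  : _~_ G y (at C s₀))
  (y∼last   : _~_ G y (at C (s₀ + (a + m + d))))
  (y≁inside : ∀ t → 0 < t → t < a + m + d → ¬ _~_ G y (at C (s₀ + t)))
  (x-span   : HolePositions.Span C x s₀ a m)
  where

  open Graph G using () renaming (~-sym to ∼-sym)
  open InducedPaths G
  open HolePositions C
  open Span x-span renaming (∼left to x∼a; ∼right to x∼b; within to x-within)

  s : ℕ
  s = a + m + d

  pos : Walk
  pos t = at C (s₀ + t)

  pos≢x : ∀ t → pos t ≢ x
  pos≢x t = x∉C (idx C (s₀ + t))

  pos≢y : ∀ t → pos t ≢ y
  pos≢y t = y∉C (idx C (s₀ + t))

  y∼pos0 : y ∼ pos 0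
  y∼pos0 = subst (λ t → y ∼ at C t) (sym (+-identityʳ s₀)) y∼first

  2≤m : 2 ≤ m
  2≤m = ≤-trans (n≤1+n 2) 3≤m

  a≤s : a ≤ s
  a≤s = ≤-trans (m≤m+n a m) (m≤m+n (a + m) d)

  m≤s : m ≤ s
  m≤s = ≤-trans (m≤n+m m a) (m≤m+n (a + m) d)

  a+m+j≤s : ∀ {j} → j ≤ d → a + m + j ≤ s
  a+m+j≤s = +-monoʳ-≤ (a + m)

  s+2≤L : s + 2 ≤ L
  s+2≤L = ≤-trans (+-monoʳ-≤ s (n≤1+n 2)) room

  P-path : IsInducedPath s pos
  P-path = isInducedPath-arc s₀ s s+2≤L

  pos-injective : ∀ {t t'} → t ≤ s → t' ≤ s → pos t ≡ pos t' → t ≡ t'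
  pos-injective = IsInducedPath.injective P-path

  y∼pos⇒ends : ∀ {t} → t ≤ s → y ∼ pos t → t ≡ 0 ⊎ t ≡ s
  y∼pos⇒ends {zero}  _   _   = inj₁ refl
  y∼pos⇒ends {suc t} t≤s y∼t with m≤n⇒m<n∨m≡n t≤s
  ... | inj₁ t<s = contradiction y∼t (y≁inside (suc t) (s≤s z≤n) t<s)
  ... | inj₂ t≡s = inj₂ t≡s

  x∼pos⇒span : ∀ {t} → t ≤ s → x ∼ pos t → a ≤ t × t ≤ a + m
  x∼pos⇒span {t} t≤s x∼t with x-within (s₀ + t) x∼t
  ... | t' , a≤t' , t'≤a+m , eq with pos-injective (≤-trans t'≤a+m (m≤m+n (a + m) d)) t≤s eq
  ...   | refl = a≤t' , t'≤a+m

  lower-before-upper : ∀ {i} j → i ≤ a → suc i < a + m + j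
  lower-before-upper {i} j i≤a = ≤-<-trans (s≤s i≤a) (≤-trans a+2≤a+m (m≤m+n (a + m) j))
    where
      a+2≤a+m : 2 + a ≤ a + m
      a+2≤a+m = subst (_≤ a + m) (+-comm a 2) (+-monoʳ-≤ a 2≤m)

  a<s : a < s
  a<s = <-≤-trans (m<m+n a (≤-trans (s≤s z≤n) 3≤m)) (m≤m+n (a + m) d)

  s<L : s < L
  s<L = <-≤-trans (m<m+n s (s≤s z≤n)) s+2≤L

  lowerQ : SubPath G C
  lowerQ = record { start = s₀ ; slen = a ; slen<len = <-trans a<s s<L }

  lowerQ⊆P : ∀ v → InSub lowerQ v → Image s pos v
  lowerQ⊆P v (t , t≤a , eq) = t , ≤-trans t≤a a≤s , eq

  lowerGap : XYGap G C x y lowerQ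
  lowerGap with xy-path-through (isInducedPath-reverse (isInducedPath-shift 0 a a≤s P-path))
                  (λ _ → pos≢x _) (λ _ → pos≢y _) x≢y x≁y x-only-first y-only-last x∼a
                  (subst (λ t → pos t ∼ y) (sym (n∸n≡0 a)) (∼-sym y∼pos0))
    where
      x-only-first : ∀ {i} → i ≤ a → x ∼ pos (a ∸ i) → i ≡ 0
      x-only-first {i} i≤a x∼ = ∸-cancelˡ-≡ i≤a z≤n
        (≤-antisym (m∸n≤m a i) (proj₁ (x∼pos⇒span (≤-trans (m∸n≤m a i) a≤s) x∼)))
      y-only-last : ∀ {i} → i ≤ a → pos (a ∸ i) ∼ y → i ≡ a
      y-only-last {i} i≤a ∼y with y∼pos⇒ends (≤-trans (m∸n≤m a i) a≤s) (∼-sym ∼y)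
      ... | inj₁ a∸i≡0 = ∸-cancelˡ-≡ i≤a ≤-refl (trans a∸i≡0 (sym (n∸n≡0 a)))
      ... | inj₂ a∸i≡s = contradiction (≤-trans (≤-reflexive (sym a∸i≡s)) (m∸n≤m a i)) (<⇒≱ a<s)
  ... | R , R-first , R-last , interior =
    R , (R-first , R-last) , λ v → Eq.trans (interior v) image-reverse

  upperQ : SubPath G C
  upperQ = record { start = s₀ + (a + m) ; slen = d ; slen<len = ≤-<-trans (m≤n+m d (a + m)) s<L }

  upperQ⊆P : ∀ v → InSub upperQ v → Image s pos v
  upperQ⊆P v (t , t≤d , eq) = a + m + t , a+m+j≤s t≤d , trans (cong (at C) (sym (+-assoc s₀ (a + m) t))) eq

  upper : Walk
  upper j = pos (a + m + j)

  upper-path : IsInducedPath d upper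
  upper-path = isInducedPath-shift (a + m) d ≤-refl P-path

  x∼upper⇒first : ∀ {j} → j ≤ d → x ∼ upper j → j ≡ 0
  x∼upper⇒first {j} j≤d x∼ = n≤0⇒n≡0 (+-cancelˡ-≤ (a + m) j 0
    (≤-trans (proj₂ (x∼pos⇒span (a+m+j≤s j≤d) x∼)) (≤-reflexive (sym (+-identityʳ (a + m))))))

  y∼upper⇒last : ∀ {j} → j ≤ d → y ∼ upper j → j ≡ d
  y∼upper⇒last {j} j≤d y∼ with y∼pos⇒ends (a+m+j≤s j≤d) y∼
  ... | inj₁ a+m+j≡0 = contradiction a+m+j≡0 (≢-sym (<⇒≢ (<-trans (s≤s z≤n) (lower-before-upper j z≤n))))
  ... | inj₂ a+m+j≡s = +-cancelˡ-≡ (a + m) j d a+m+j≡s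

  x∼upper0 : x ∼ upper 0
  x∼upper0 = subst (λ t → x ∼ pos t) (sym (+-identityʳ (a + m))) x∼b

  upperGap : XYGap G C x y upperQ
  upperGap with xy-path-through upper-path (λ _ → pos≢x _) (λ _ → pos≢y _) x≢y x≁y
                  x∼upper⇒first (λ j≤d → y∼upper⇒last j≤d ∘ ∼-sym) x∼upper0 (∼-sym y∼last)
  ... | R , R-first , R-last , interior =
    R , (R-first , R-last) , λ v → Eq.trans (interior v)
      (image-cong (λ j → cong (at C) (sym (+-assoc s₀ (a + m) j))))

  2≤s : 2 ≤ s
  2≤s = ≤-trans 2≤m m≤s

  yHole : Hole G
  yHole = toHole (s≤s (s≤s 2≤s)) (isInducedCycle-apex P-path (λ _ → pos≢y _) y∼pos⇒ends y∼pos0 y∼last)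

  k : ℕ
  k = L ∸ m

  m+k≡L : m + k ≡ L
  m+k≡L = m+[n∸m]≡n (≤-trans m≤s (<⇒≤ s<L))

  a+d+3≤k : a + d + 3 ≤ k
  a+d+3≤k = +-cancelˡ-≤ m (a + d + 3) k (subst₂ _≤_ (rearrange a m d) (sym m+k≡L) room)
    where
      rearrange : ∀ a m d → a + m + d + 3 ≡ m + (a + d + 3)
      rearrange = solve-∀

  k+3≤L : k + 3 ≤ L
  k+3≤L = ≤-trans (+-monoʳ-≤ k 3≤m) (≤-reflexive (trans (+-comm k m) m+k≡L))

  -- C read from p_(a+m) onwards; its k-th vertex is p_(a+|C|) = pₐ.
  outer : Walk
  outer e = at C (s₀ + (a + m) + e)

  pos-≡⇒ : ∀ {t t'} → t ≤ t' → t' ≤ t + L → pos t ≡ pos t' → t' ≡ t ⊎ t' ≡ t + L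
  pos-≡⇒ {t} {t'} t≤t' t'≤t+L eq =
    Sum.map (+-cancelˡ-≡ s₀ t' t) (λ wrapped → +-cancelˡ-≡ s₀ t' (t + L) (trans wrapped (+-assoc s₀ t L)))
      (%-≡⇒≡∨≡+ L (+-monoʳ-≤ s₀ t≤t')
        (≤-trans (+-monoʳ-≤ s₀ t'≤t+L) (≤-reflexive (sym (+-assoc s₀ t L))))
        (Equivalence.to at-≡⇔ eq))

  x∼outer⇒ends : ∀ {e} → e ≤ k → x ∼ outer e → e ≡ 0 ⊎ e ≡ k
  x∼outer⇒ends {e} e≤k x∼ with x-within _ x∼
  ... | t , a≤t , t≤a+m , eq with pos-≡⇒ (≤-trans t≤a+m (m≤m+n (a + m) e)) a+m+e≤t+L
                                   (trans eq (cong (at C) (+-assoc s₀ (a + m) e)))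
    where
      a+m+e≤t+L : a + m + e ≤ t + L
      a+m+e≤t+L = begin
        a + m + e    ≤⟨ +-monoʳ-≤ (a + m) e≤k ⟩
        a + m + k    ≡⟨ trans (+-assoc a m k) (cong (a +_) m+k≡L) ⟩
        a + L        ≤⟨ +-monoˡ-≤ L a≤t ⟩
        t + L        ∎
        where open ≤-Reasoning
  ... | inj₁ a+m+e≡t = inj₁ (n≤0⇒n≡0 (+-cancelˡ-≤ (a + m) e 0
          (≤-trans (≤-reflexive a+m+e≡t) (≤-trans t≤a+m (≤-reflexive (sym (+-identityʳ (a + m))))))))
  ... | inj₂ a+m+e≡t+L = inj₂ (m+n≡o+p⇒n≡p (+-cancelʳ-≡ m (a + e) (t + k) (begin
          a + e + m      ≡⟨ xy∙z≈xz∙y a e m ⟩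
          a + m + e      ≡⟨ a+m+e≡t+L ⟩
          t + L          ≡⟨ cong (t +_) m+k≡L ⟨
          t + (m + k)    ≡⟨ x∙yz≈xz∙y t m k ⟩
          t + k + m      ∎)) a≤t e≤k)
    where open ≡-Reasoning

  outerHole : Hole G
  outerHole = toHole (s≤s (s≤s (≤-trans (n≤1+n 2) (≤-trans (m≤n+m 3 (a + d)) a+d+3≤k))))
    (isInducedCycle-apex (isInducedPath-arc (s₀ + (a + m)) k (≤-trans (+-monoʳ-≤ k (n≤1+n 2)) k+3≤L))
      (λ _ → x∉C _) (λ e≤k → x∼outer⇒ends e≤k) x∼first x∼last)
    where
      x∼first : x ∼ outer 0
      x∼first = subst (λ t → x ∼ at C t) (sym (+-identityʳ (s₀ + (a + m)))) x∼b
      x∼last : x ∼ outer k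
      x∼last = subst (x ∼_) (sym (trans (cong (at C) wraps) (at-+L (s₀ + a)))) x∼a
        where
          wraps : s₀ + (a + m) + k ≡ s₀ + a + L
          wraps = trans (cong (_+ k) (sym (+-assoc s₀ a m))) (trans (+-assoc (s₀ + a) m k) (cong (s₀ + a +_) m+k≡L))

  cross : Walk
  cross = append a pos (x ◃ upper)

  cross-path : IsInducedPath (a + suc (suc d)) cross
  cross-path = isInducedPath-++ (isInducedPath-shift 0 a a≤s P-path) x◃upper-path disjoint only-link (∼-sym x∼a)
    where
      x◃upper-path : IsInducedPath (suc d) (x ◃ upper)
      x◃upper-path = isInducedPath-++ (isInducedPath-singleton x) upper-path
        (λ _ _ x≡ → pos≢x _ (sym x≡)) (λ { z≤n j≤d x∼ → refl , x∼upper⇒first j≤d x∼ }) x∼upper0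
      disjoint : ∀ {i j} → i ≤ a → j ≤ suc d → pos i ≢ (x ◃ upper) j
      disjoint {i} {zero}  _   _         = pos≢x i
      disjoint {i} {suc j} i≤a (s≤s j≤d) =
        <⇒≢ (<-trans (n<1+n i) (lower-before-upper j i≤a)) ∘ pos-injective (≤-trans i≤a a≤s) (a+m+j≤s j≤d)
      only-link : ∀ {i j} → i ≤ a → j ≤ suc d → pos i ∼ (x ◃ upper) j → i ≡ a × j ≡ 0
      only-link {i} {zero}  i≤a _ i∼x =
        ≤-antisym i≤a (proj₁ (x∼pos⇒span (≤-trans i≤a a≤s) (∼-sym i∼x))) , refl
      only-link {i} {suc j} i≤a (s≤s j≤d) i∼
        with IsInducedPath.adjacent⇒consecutive P-path (≤-trans i≤a a≤s) (a+m+j≤s j≤d) i∼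
      ... | inj₁ a+m+j≡1+i = contradiction (sym a+m+j≡1+i) (<⇒≢ (lower-before-upper j i≤a))
      ... | inj₂ i≡1+a+m+j =
        contradiction i≡1+a+m+j (<⇒≢ (<-trans (n<1+n i) (<-trans (lower-before-upper j i≤a) (n<1+n _))))


  crossHole : Hole G
  crossHole = toHole (s≤s (s≤s (≤-trans (s≤s (s≤s z≤n)) (m≤n+m (suc (suc d)) a))))
    (isInducedCycle-apex cross-path cross≢y y∼cross⇒ends y∼pos0 y∼cross-last)
    where
      onLeft : ∀ {i} → i ≤ a → cross i ≡ pos i
      onLeft = append-left {a} {pos} {x ◃ upper}
      onRight : ∀ j → cross (suc a + j) ≡ (x ◃ upper) j
      onRight = append-right⁺ {a} {pos} {x ◃ upper}
      cross≢y : ∀ {i} → i ≤ a + suc (suc d) → cross i ≢ y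
      cross≢y i≤ with split a (suc d) i≤
      ... | left i≤a          = pos≢y _ ∘ trans (sym (onLeft i≤a))
      ... | right {zero}  _   = x≢y ∘ trans (sym (onRight 0))
      ... | right {suc j} _   = pos≢y _ ∘ trans (sym (onRight (suc j)))
      y∼cross⇒ends : ∀ {i} → i ≤ a + suc (suc d) → y ∼ cross i → i ≡ 0 ⊎ i ≡ a + suc (suc d)
      y∼cross⇒ends i≤ y∼ with split a (suc d) i≤
      ... | left i≤a = Sum.map₂ (λ i≡s → contradiction (≤-trans (≤-reflexive (sym i≡s)) i≤a) (<⇒≱ a<s))
                         (y∼pos⇒ends (≤-trans i≤a a≤s) (subst (y ∼_) (onLeft i≤a) y∼))
      ... | right {zero}  _ = contradiction (∼-sym (subst (y ∼_) (onRight 0) y∼)) x≁y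
      ... | right {suc j} (s≤s j≤d) with y∼upper⇒last j≤d (subst (y ∼_) (onRight (suc j)) y∼)
      ...   | refl = inj₂ (sym (+-suc a (suc d)))
      y∼cross-last : y ∼ cross (a + suc (suc d))
      y∼cross-last = subst (y ∼_) (sym (trans (cong cross (+-suc a (suc d))) (onRight (suc d)))) y∼last

  crossHole-not-long : ∀ {ℓ} → ShortestLongEvenHole G ℓ C → ¬ ℓ ≤ a + d + 4
  crossHole-not-long {ℓ} shortest ℓ≤ = no-three-shorter-long-holes C shortest yHole outerHole crossHole
    (≤-trans ℓ≤cross cross≤y , y<L) (≤-trans ℓ≤cross cross≤outer , outer<L)
    (ℓ≤cross , ≤-<-trans cross≤y y<L)
    (subst (λ l → len yHole + len outerHole ≡ l + len crossHole) m+k≡L (length-balance a m d k))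
    where
      cross-length : ∀ a d → a + d + 4 ≡ suc (suc (a + suc (suc d)))
      cross-length = solve-∀
      cross-length′ : ∀ a d → a + d + 2 + 2 ≡ suc (suc (a + suc (suc d)))
      cross-length′ = solve-∀
      cross-length″ : ∀ a d → suc (a + d + 3) ≡ suc (suc (a + suc (suc d)))
      cross-length″ = solve-∀
      y-length : ∀ a m d → a + d + 2 + m ≡ suc (suc (a + m + d))
      y-length = solve-∀
      length-balance : ∀ a m d k → suc (suc (a + m + d)) + suc (suc k) ≡ m + k + suc (suc (a + suc (suc d)))
      length-balance = solve-∀
      ℓ≤cross : ℓ ≤ len crossHole
      ℓ≤cross = subst (ℓ ≤_) (cross-length a d) ℓ≤
      cross≤y : len crossHole ≤ len yHole
      cross≤y = subst₂ _≤_ (cross-length′ a d) (y-length a m d) (+-monoʳ-≤ (a + d + 2) 2≤m)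
      cross≤outer : len crossHole ≤ len outerHole
      cross≤outer = subst (_≤ suc (suc k)) (cross-length″ a d) (s≤s (m≤n⇒m≤1+n a+d+3≤k))
      y<L : len yHole < L
      y<L = subst (_≤ L) (+-comm s 3) room
      outer<L : len outerHole < L
      outer<L = subst (_≤ L) (+-comm k 3) k+3≤L

  xy-gap : ∀ {ℓ} → ShortestLongEvenHole G ℓ C →
    Σ[ Q ∈ SubPath G C ] (XYGap G C x y Q × slen Q + 3 ≤ ⌈ ℓ /2⌉ × (∀ v → InSub Q v → Image s pos v))
  xy-gap {ℓ} shortest with ⌈/2⌉-split ℓ a d
  ... | inj₁ a+3≤        = lowerQ , lowerGap , a+3≤ , lowerQ⊆P
  ... | inj₂ (inj₁ d+3≤) = upperQ , upperGap , d+3≤ , upperQ⊆P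
  ... | inj₂ (inj₂ long) = contradiction long (crossHole-not-long shortest)

lemma2p29 : (ℓ : ℕ) → 4 ≤ ℓ → (n : ℕ) (G : Graph n) (C : Hole G) →
    ShortestLongEvenHole G ℓ C →
    (x y : Fin n) → x ≢ y → ¬ (_~_ G x y) →
    Major G C x → Major G C y →
    (P : SubPath G C) → Gap G C y P →
    (∀ i → _~_ G x (cyc C i) → InSub P (cyc C i)) →
    Σ[ Q ∈ SubPath G C ] (XYGap G C x y Q × slen Q + 3 ≤ ⌈ ℓ /2⌉
      × (∀ v → InSub Q v → InSub P v))
lemma2p29 ℓ _ n G C shortest x y x≢y x≁y x-major y-major
  P@(record { start = s₀ ; slen = _ ; slen<len = _ }) y-gap@(_ , y∼first , y∼last , y≁inside) x-in-P
  with HolePositions.major-span C {P = P} x-major x-in-P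
... | a , m , d , refl , 4≤m , x-span =
  Configuration.xy-gap C (proj₁ x-major) (proj₁ y-major) x≢y x≁y s₀ a m d (≤-trans (n≤1+n 3) 4≤m)
    (HolePositions.gap-leaves-room C {P = P} y-major y-gap) y∼first y∼last y≁inside x-span shortest
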